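{- Let $G$ be a graph of bounded degree which is quasi-isometric to a tree. Then $G$ contains no subdivision of the half-grid.
   Context: Graphs carry the graph distance. A map $f\colon V(G)\to V(T)$ is a $(\gamma,c)$-quasi-isometry ($\gamma\ge1,c\ge0$) if $\frac1\gamma d_G(u,v)-c\le d_T(f(u),f(v))\le\gamma d_G(u,v)+c$ for all $u,v$ and every vertex of $T$ is within distance $c$ of $f(V(G))$; $G$ is quasi-isometric to a tree if such a map to some tree $T$ exists. $\mathbb{H}$ denotes the hexagonal (honeycomb) lattice, the infinite 3-regular plane graph all of whose faces are hexagons, drawn in $\mathbb{R}^2$ in the standard way; the half-grid is the intersection of $\mathbb{H}$ with the upper half-plane. A subdivision of $H$ in $G$ is a topological embedding of the 1-complex of $H$ into that of $G$ mapping vertices to vertices (vertices to distinct vertices, edges to internally disjoint paths between the images of their endpoints). -}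

module Defs where

open import Data.Nat using (ℕ; zero; suc; _+_; _*_; _≤_; _%_; _≡ᵇ_)
open import Data.Integer as ℤ using (ℤ; +_)
open import Data.Bool using (Bool; T)
open import Data.Product using (Σ; _×_; _,_; ∃; ∃-syntax)
open import Data.Sum using (_⊎_)
open import Data.List using (List; []; _∷_; length)
open import Data.List.Membership.Propositional using (_∈_)
open import Data.List.Relation.Unary.Unique.Propositional using (Unique)
open import Relation.Binary.PropositionalEquality using (_≡_)
open import Relation.Nullary using (¬_)
open import Function using (Injective)

record Graph : Set₁ where
  field
    V : Set
    E : V → V → Set
open Graph public

IsSimple : Graph → Set
IsSimple G = (∀ u v → E G u v → E G v u) × (∀ v → ¬ E G v v)

data Walk (G : Graph) : V G → V G → ℕ → Set where
  here : ∀ {v} → Walk G v v 0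
  step : ∀ {u w v n} → E G u w → Walk G w v n → Walk G u v (suc n)

DistLe : (G : Graph) → V G → V G → ℕ → Set
DistLe G u v n = ∃[ m ] (m ≤ n × Walk G u v m)

data Chain (G : Graph) : V G → List (V G) → V G → Set where
  last : ∀ {a b} → E G a b → Chain G a [] b
  cons : ∀ {a x xs b} → E G a x → Chain G x xs b → Chain G a (x ∷ xs) b

BoundedDegree : Graph → Set
BoundedDegree G =
  ∃[ Δ ] (∀ v → ∃[ ns ] (length ns ≤ Δ × (∀ w → E G v w → w ∈ ns)))

Connected : Graph → Set
Connected G = ∀ u v → ∃[ n ] Walk G u v n

HasCycle : Graph → Set
HasCycle G = Σ (V G) λ v → Σ (List (V G)) λ xs →
  (2 ≤ length xs) × Unique (v ∷ xs) × Chain G v xs v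

IsTree : Graph → Set
IsTree T = IsSimple T × Connected T × ¬ HasCycle T

-- Quasi-isometry with (natural-number) constants γ ≥ 1, c ≥ 0, written
-- so that the multiplicative constant is cleared:
--   (1/γ) d_G(u,v) - c ≤ d_T(fu,fv)   ⇔   d_G(u,v) ≤ γ (d_T(fu,fv) + c).

IsQI : (G T : Graph) → (V G → V T) → ℕ → ℕ → Set
IsQI G T f γ c =
  (1 ≤ γ)
  × (∀ u v n → DistLe G u v n → DistLe T (f u) (f v) (γ * n + c))
  × (∀ u v n → DistLe T (f u) (f v) n → DistLe G u v (γ * (n + c)))
  × (∀ t → ∃[ v ] DistLe T t (f v) c)

QuasiIsometricToTree : Graph → Set₁
QuasiIsometricToTree G =
  Σ Graph λ T → IsTree T × Σ (V G → V T) λ f → ∃[ γ ] ∃[ c ] IsQI G T f γ c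

SameEdge : {A : Set} → A → A → A → A → Set
SameEdge u v u' v' = (u ≡ u' × v ≡ v') ⊎ (u ≡ v' × v ≡ u')

record Subdivision (H G : Graph) : Set where
  field
    φ        : V H → V G
    φ-inj    : Injective _≡_ _≡_ φ
    path     : ∀ u v → E H u v → List (V G)
    isChain  : ∀ u v (e : E H u v) → Chain G (φ u) (path u v e) (φ v)
    isPath   : ∀ u v (e : E H u v) → Unique (path u v e)
    avoidImg : ∀ u v (e : E H u v) w x → x ∈ path u v e → ¬ (x ≡ φ w)
    disjoint : ∀ u v (e : E H u v) u' v' (e' : E H u' v') x →
               x ∈ path u v e → x ∈ path u' v' e' → SameEdge u v u' v'

-- The hexagonal lattice is realised as the brick wall on
-- ℤ × ℤ: (x,y) ~ (x±1,y), and (x,y) ~ (x,y+1) iff x + y is even.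
-- The half-grid is its restriction to y ≥ 0, i.e. vertices ℤ × ℕ.

isEven : ℤ → Bool
isEven z = (ℤ.∣ z ∣ % 2) ≡ᵇ 0

data HalfGridArc : ℤ × ℕ → ℤ × ℕ → Set where
  horiz : ∀ x y → HalfGridArc (x , y) (x ℤ.+ + 1 , y)
  vert  : ∀ x y → T (isEven (x ℤ.+ + y)) → HalfGridArc (x , y) (x , suc y)

HalfGrid : Graph
HalfGrid = record
  { V = ℤ × ℕ
  ; E = λ p q → HalfGridArc p q ⊎ HalfGridArc q p
  }

-- A subdivided half-grid contains, for every k, k disjoint walks (rows) and k disjoint walks
-- (columns) such that every row meets every column. Let f : G → T be a quasi-isometry to a tree.
-- The vertices of G mapped close to a vertex t of T have bounded diameter, so by bounded degree
-- they meet fewer than k rows and fewer than k columns when k is large; a row and a column avoiding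
-- them form a connected set, which f maps into a single branch of T at t. Pointing every t towards
-- such a branch never points back along an edge, because any two row–column crosses meet. Hence
-- following the pointers from a vertex t₀ walks away from t₀ forever, while every branch pointed
-- to contains the image of one of the finitely many row–column intersections.

module Submission where

open import Defs
open import Level using (0ℓ)
open import Function using (_∘_)
open import Data.Bool using (T)
open import Data.Empty using (⊥; ⊥-elim)
open import Data.Unit using (tt)
open import Data.Product using (Σ; _×_; _,_; ∃₂; ∃-syntax; proj₁; proj₂)
open import Data.Sum as Sum using (_⊎_; inj₁; inj₂)
open import Data.Nat
  using (ℕ; zero; suc; _+_; _*_; _≤_; _<_; _⊔_; ⌊_/2⌋; z≤n; s≤s; s≤s⁻¹; z<s)
open import Data.Nat.Properties
  using (≤-refl; ≤-trans; ≤-<-trans; <-≤-trans; <⇒≤; m≤m+n; m≤n+m; m<m+n; m≤m⊔n; m≤n⊔m;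
         +-mono-≤; *-monoˡ-≤; +-identityʳ; +-assoc; +-suc; *-distribʳ-+)
open import Data.Nat.DivMod using (m*n%n≡0)
open import Data.Nat.Tactic.RingSolver using (solve-∀)
open import Data.Integer as ℤ using (+_)
open import Data.Fin as Fin using (Fin; toℕ)
open import Data.Fin.Properties
  using (pigeonhole; toℕ-injective; toℕ<n) renaming (<⇒≢ to <⇒≢ᶠ)
open import Data.List using (List; []; _∷_; length; _++_; concatMap; lookup)
open import Data.List.Properties using (length-++)
open import Data.List.Membership.Propositional using (_∈_; _∉_; find; lose)
open import Data.List.Membership.Propositional.Properties
  using (∈-concatMap⁺; ∈-++⁺ʳ; ∈-++⁻)
open import Data.List.Relation.Unary.All as All using (All; []; _∷_)
open import Data.List.Relation.Unary.All.Properties using (¬Any⇒All¬)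
open import Data.List.Relation.Unary.AllPairs using ([]; _∷_)
open import Data.List.Relation.Unary.Any as Any using (Any; here; there)
open import Data.List.Relation.Unary.Any.Properties using (lookup-index)
open import Data.List.Relation.Unary.Linked using (Linked; [-]; _∷_)
open import Data.List.Relation.Unary.Unique.Propositional using (Unique)
open import Effect.Monad using (RawMonad)
open import Relation.Binary using (Rel; Symmetric)
open import Relation.Binary.PropositionalEquality
  using (module ≡-Reasoning; _≡_; _≢_; refl; sym; trans; cong; subst; ≢-sym)
open import Relation.Nullary using (¬_; yes; no)
open import Relation.Nullary.Decidable using (¬¬-excluded-middle)
open import Relation.Nullary.Negation using (¬¬-Monad)
open import Relation.Unary using (Pred; U; _∩_; _⊆_)

-- Equality of vertices is not decidable, so every case distinction on vertices is made in the
-- double-negation monad; this costs nothing, since the theorem is a negation.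
open RawMonad (¬¬-Monad {0ℓ}) using (_>>=_; _<$>_; return)

¬¬-pull-Fin : ∀ {n} {P : Pred (Fin n) 0ℓ} → (∀ i → ¬ ¬ P i) → ¬ ¬ (∀ i → P i)
¬¬-pull-Fin {zero}  _   = return λ ()
¬¬-pull-Fin {suc n} ¬¬P = do
  P₀ ← ¬¬P Fin.zero
  Pₛ ← ¬¬-pull-Fin (¬¬P ∘ Fin.suc)
  return λ where
    Fin.zero    → P₀
    (Fin.suc i) → Pₛ i

finite-bound : ∀ {n} (g : Fin n → ℕ) → ∃[ D ] (∀ i → g i ≤ D)
finite-bound {zero}  g = 0 , λ ()
finite-bound {suc n} g = g Fin.zero ⊔ D , λ where
    Fin.zero    → m≤m⊔n _ _
    (Fin.suc i) → ≤-trans (g≤D i) (m≤n⊔m _ D)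
  where open Σ (finite-bound (g ∘ Fin.suc)) renaming (proj₁ to D; proj₂ to g≤D)

length-concatMap-≤ : ∀ {A B : Set} {f : A → List B} {k} xs →
                     (∀ x → length (f x) ≤ k) → length (concatMap f xs) ≤ length xs * k
length-concatMap-≤         []       _   = z≤n
length-concatMap-≤ {f = f} (x ∷ xs) f≤k =
  subst (_≤ _) (sym (length-++ (f x))) (+-mono-≤ (f≤k x) (length-concatMap-≤ xs f≤k))

module _ {A : Set} {R : Rel A 0ℓ} {P Q : Pred A 0ℓ} (symmetric : Symmetric R)
         (transfer : ∀ {x y} → R x y → P y → Q x → Q y) where

  linked-spread : ∀ {xs} → Linked R xs → All P xs → Any Q xs → All Q xs
  linked-spread {_ ∷ _} linked ps q = forward linked ps (backward linked ps q)
    where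
    backward : ∀ {x xs} → Linked R (x ∷ xs) → All P (x ∷ xs) → Any Q (x ∷ xs) → Q x
    backward _       _         (here qx) = qx
    backward (r ∷ l) (px ∷ ps) (there q) = transfer (symmetric r) px (backward l ps q)
    forward : ∀ {x xs} → Linked R (x ∷ xs) → All P (x ∷ xs) → Q x → All Q (x ∷ xs)
    forward [-]     _        qx = qx ∷ []
    forward (r ∷ l) (_ ∷ ps) qx = qx ∷ forward l ps (transfer r (All.head ps) qx)

module Walks (G : Graph) where

  data WalkIn (P : Pred (V G) 0ℓ) : V G → V G → ℕ → Set where
    here : ∀ {v} → P v → WalkIn P v v 0
    step : ∀ {u w v n} → P u → E G u w → WalkIn P w v n → WalkIn P u v (suc n)

  private variable
    P Q : Pred (V G) 0ℓ
    u v w z : V G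
    m n : ℕ

  head : WalkIn P u v n → P u
  head (here p)     = p
  head (step p _ _) = p

  final : WalkIn P u v n → P v
  final (here p)     = p
  final (step _ _ ω) = final ω

  map : P ⊆ Q → WalkIn P u v n → WalkIn Q u v n
  map P⊆Q (here p)     = here (P⊆Q p)
  map P⊆Q (step p e ω) = step (P⊆Q p) e (map P⊆Q ω)

  _++ʷ_ : WalkIn P u v m → WalkIn P v w n → WalkIn P u w (m + n)
  here _     ++ʷ ω′ = ω′
  step p e ω ++ʷ ω′ = step p e (ω ++ʷ ω′)

  snoc : WalkIn P u v n → E G v w → P w → WalkIn P u w (suc n)
  snoc (here p)     e  pw = step p e (here pw)
  snoc (step p e ω) e′ pw = step p e (snoc ω e′ pw)

  reverse : (∀ {x y} → E G x y → E G y x) → WalkIn P u v n → WalkIn P v u n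
  reverse sym (here p)     = here p
  reverse sym (step p e ω) = snoc (reverse sym ω) (sym e) p

  fromWalk : Walk G u v n → WalkIn U u v n
  fromWalk here       = here tt
  fromWalk (step e ω) = step tt e (fromWalk ω)

  toWalk : WalkIn P u v n → Walk G u v n
  toWalk (here _)     = here
  toWalk (step _ e ω) = step e (toWalk ω)

  dist-trans : DistLe G u v m → DistLe G v w n → DistLe G u w (m + n)
  dist-trans (m′ , m′≤m , ω) (n′ , n′≤n , ω′) =
    m′ + n′ , +-mono-≤ m′≤m n′≤n , toWalk (fromWalk ω ++ʷ fromWalk ω′)

  dist-sym : (∀ {x y} → E G x y → E G y x) → DistLe G u v n → DistLe G v u n
  dist-sym sym (m , m≤n , ω) = m , m≤n , toWalk (reverse sym (fromWalk ω))

  Passes : ∀ z → Pred (V G) 0ℓ → V G → V G → ℕ → Set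
  Passes z P u v n = ∃₂ λ n₁ n₂ → n₁ + n₂ ≡ n × WalkIn P u z n₁ × WalkIn P z v n₂

  passes-step : P u → E G u w → Passes z P w v n → Passes z P u v (suc n)
  passes-step p e (n₁ , n₂ , eq , ω₁ , ω₂) = suc n₁ , n₂ , cong suc eq , step p e ω₁ , ω₂

  Split : ∀ z → Pred (V G) 0ℓ → V G → V G → ℕ → Set
  Split z P u v n = WalkIn (P ∩ (z ≢_)) u v n ⊎ Passes z P u v n

  split-at : ∀ z → WalkIn P u v n → ¬ ¬ Split z P u v n
  split-at-tail : z ≢ u → WalkIn P u v n → ¬ ¬ Split z P u v n

  split-at {u = u} z ω = ¬¬-excluded-middle {A = z ≡ u} >>= λ where
    (yes refl) → return (inj₂ (0 , _ , refl , here (head ω) , ω))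
    (no z≢u)   → split-at-tail z≢u ω

  split-at-tail z≢u (here p)     = return (inj₁ (here (p , z≢u)))
  split-at-tail {z = z} z≢u (step p e ω) = Sum.map (step (p , z≢u) e) (passes-step p e) <$> split-at z ω

  last-edge : WalkIn P u z n → z ≢ u →
              ¬ ¬ (∃₂ λ w m → WalkIn (P ∩ (z ≢_)) u w m × E G w z)
  last-edge (here _) z≢u = λ _ → z≢u refl
  last-edge {z = z} (step {w = w} p e ω) z≢u = ¬¬-excluded-middle {A = z ≡ w} >>= λ where
    (yes refl) → return (_ , 0 , here (p , z≢u) , e)
    (no z≢w)   → do
      (w′ , m , ω′ , e′) ← last-edge ω z≢w
      return (w′ , suc m , step (p , z≢u) e ω′ , e′)

module Acyclic (G : Graph) (acyclic : ¬ HasCycle G) where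

  open Walks G

  -- Each vertex joins the forbidden list F of its successors, so the vertices are pairwise distinct.
  data PathAvoiding (F : List (V G)) : V G → V G → Set where
    [_] : ∀ {v} → v ∉ F → PathAvoiding F v v
    _∷⟨_⟩_ : ∀ {u w v} → u ∉ F → E G u w → PathAvoiding (u ∷ F) w v → PathAvoiding F u v

  private variable
    F : List (V G)
    u v x y : V G

  ∉-∷ : x ∉ F → y ≢ x → x ∉ y ∷ F
  ∉-∷ x∉F y≢x (here x≡y)  = y≢x (sym x≡y)
  ∉-∷ x∉F y≢x (there x∈F) = x∉F x∈F

  ∉-∷⁻ : x ∉ y ∷ F → y ≢ x
  ∉-∷⁻ x∉ y≡x = x∉ (here (sym y≡x))

  vertices : PathAvoiding F u v → List (V G)
  vertices {u = u} [ _ ]        = u ∷ []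
  vertices {u = u} (_ ∷⟨ _ ⟩ π) = u ∷ vertices π

  vertices-avoid : (π : PathAvoiding F u v) → All (_∉ F) (vertices π)
  vertices-avoid [ u∉F ]        = u∉F ∷ []
  vertices-avoid (u∉F ∷⟨ _ ⟩ π) = u∉F ∷ All.map (_∘ there) (vertices-avoid π)

  vertices-unique : (π : PathAvoiding F u v) → Unique (vertices π)
  vertices-unique [ _ ]        = [] ∷ []
  vertices-unique (_ ∷⟨ _ ⟩ π) = All.map ∉-∷⁻ (vertices-avoid π) ∷ vertices-unique π

  vertices-chain : E G x u → (π : PathAvoiding F u v) → E G v y → Chain G x (vertices π) y
  vertices-chain e [ _ ]         e′ = cons e (last e′)
  vertices-chain e (_ ∷⟨ e″ ⟩ π) e′ = cons e (vertices-chain e″ π e′)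

  vertices-length : (π : PathAvoiding F u v) → u ≢ v → 2 ≤ length (vertices π)
  vertices-length [ _ ]                   u≢v = ⊥-elim (u≢v refl)
  vertices-length (_ ∷⟨ _ ⟩ [ _ ])        u≢v = s≤s (s≤s z≤n)
  vertices-length (_ ∷⟨ _ ⟩ (_ ∷⟨ _ ⟩ _)) u≢v = s≤s (s≤s z≤n)

  -- Loop erasure: the walk is cut at its first return to the start; N bounds the length.
  to-path : ∀ {n} N → n ≤ N → WalkIn (_∉ F) u v n → ¬ ¬ PathAvoiding F u v
  to-path N       _         (here u∉F)     = return [ u∉F ]
  to-path (suc N) (s≤s n≤N) (step u∉F e ω) = split-at _ ω >>= λ where
    (inj₁ ω′) → (u∉F ∷⟨ e ⟩_) <$> to-path N n≤N (map (λ (x∉F , u≢x) → ∉-∷ x∉F u≢x) ω′)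
    (inj₂ (n₁ , n₂ , refl , _ , ω₂)) → to-path N (≤-trans (m≤n+m n₂ n₁) n≤N) ω₂

  no-detour : ∀ {c a b n} → E G c a → E G b c → a ≢ b → ¬ WalkIn (c ≢_) a b n
  no-detour {c} {n = n} e e′ a≢b ω =
    to-path n ≤-refl (map (∉-∷ {F = []} (λ ())) ω) λ π →
      acyclic (c , vertices π , vertices-length π a≢b ,
               All.map ∉-∷⁻ (vertices-avoid π) ∷ vertices-unique π , vertices-chain e π e′)

module Branches (T : Graph) (sym : ∀ {x y} → E T x y → E T y x) (acyclic : ¬ HasCycle T) where

  open Walks T
  open Acyclic T acyclic

  -- x lies in the component of T − t that contains s.
  Branch : V T → V T → Pred (V T) 0ℓ
  Branch t s x = ∃[ n ] WalkIn (t ≢_) x s n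

  private variable
    a b s t x y : V T
    n : ℕ

  branches-disjoint : E T t s → Branch t s x → ¬ Branch s t x
  branches-disjoint t–s (_ , ω₁) (_ , ω₂) =
    last-edge ω₂ (head ω₁) λ (w , _ , ω , w–t) →
    no-detour t–s w–t (proj₁ (final ω)) (reverse sym ω₁ ++ʷ map proj₂ ω)

  branch-of : Connected T → t ≢ x → ¬ ¬ (∃[ s ] E T t s × Branch t s x)
  branch-of {t} {x} connected t≢x = do
    (s , m , ω , s–t) ← last-edge (fromWalk (proj₂ (connected x t))) t≢x
    return (s , sym s–t , m , map proj₂ ω)

  branch-behind : E T a b → E T b s → s ≢ a → s ≢ b → Branch b a x → ¬ ¬ Branch s b x
  branch-behind a–b b–s s≢a s≢b (n , ω) = split-at _ ω >>= λ where
    (inj₁ ω′) → return (suc n , snoc (map proj₂ ω′) a–b s≢b)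
    (inj₂ (_ , _ , _ , _ , ω₂)) → λ _ → no-detour b–s a–b s≢a ω₂

  branch-stable : ∀ {L} → DistLe T x y L → ¬ DistLe T x t L →
                  Branch t s y → ¬ ¬ Branch t s x
  branch-stable (m , m≤L , ω) far (k , ω′) = split-at _ (fromWalk ω) >>= λ where
    (inj₁ ω₁) → return (m + k , map proj₂ ω₁ ++ʷ ω′)
    (inj₂ (n₁ , n₂ , refl , ω₁ , _)) → λ _ →
      far (n₁ , ≤-trans (m≤m+n n₁ n₂) m≤L , toWalk ω₁)

  Beyond : V T → ℕ → V T → V T → Set
  Beyond t₀ n a b = ∀ {x} → Branch a b x → ¬ DistLe T t₀ x n

  beyond-step : ∀ {t₀} → a ≢ b → E T b s → Branch s b t₀ →
                Beyond t₀ n a b → Beyond t₀ (suc n) b s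
  beyond-step a≢b b–s behind beyond (k , ω′) (m , m≤1+n , ω) =
    split-at _ (fromWalk ω) λ where
    (inj₁ ω₁) → branches-disjoint b–s (m + k , map proj₂ ω₁ ++ʷ ω′) behind
    (inj₂ (_ , zero , _ , _ , here _)) → head ω′ refl
    (inj₂ (n₁ , suc n₂ , refl , ω₁ , _)) →
      beyond (0 , here a≢b) (n₁ , s≤s⁻¹ (<-≤-trans (m<m+n n₁ z<s) m≤1+n) , toWalk ω₁)

  record AnchoredOrientation (t₀ : V T) (D : ℕ) : Set₁ where
    field
      Points   : V T → V T → Set
      points   : ∀ t → ¬ ¬ (∃[ s ] E T t s × Points t s)
      antisym  : E T a b → Points a b → ¬ Points b a
      anchored : Points t s → ¬ ¬ (∃[ x ] Branch t s x × DistLe T t₀ x D)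

  module _ (irreflexive : ∀ v → ¬ E T v v) {t₀ D} (O : AnchoredOrientation t₀ D) where
    open AnchoredOrientation O

    -- Following the orientation from t₀ gives a walk that never backtracks, hence leaves every ball.
    record Ray (n : ℕ) : Set where
      field
        {u v}  : V T
        u–v    : E T u v
        u→v    : Points u v
        behind : Branch v u t₀
        beyond : Beyond t₀ n u v

    adjacent-distinct : E T x y → x ≢ y
    adjacent-distinct e refl = irreflexive _ e

    ray : ∀ n → ¬ ¬ Ray n
    ray zero = do
      (s , t₀–s , t₀→s) ← points t₀
      return record
        { u–v = t₀–s ; u→v = t₀→s ; behind = 0 , here (≢-sym (adjacent-distinct t₀–s))
        ; beyond = λ { (_ , ω) (zero , _ , here) → head ω refl ; _ (suc _ , () , _) } }
    ray (suc n) = do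
      r ← ray n
      let open Ray r
      (w , v–w , v→w) ← points v
      let w≢u = λ { refl → antisym u–v u→v v→w }
      behind′ ← branch-behind u–v v–w w≢u (≢-sym (adjacent-distinct v–w)) behind
      return record { u–v = v–w ; u→v = v→w ; behind = behind′
                    ; beyond = beyond-step (adjacent-distinct u–v) v–w behind′ beyond }

    ¬anchored-orientation : ⊥
    ¬anchored-orientation =
      ray D λ r → anchored (Ray.u→v r) λ (_ , x∈ , near) → Ray.beyond r x∈ near

module Balls (G : Graph) (bounded : BoundedDegree G) where

  private
    Δ : ℕ
    Δ = proj₁ bounded

    neighbours : V G → List (V G)
    neighbours v = proj₁ (proj₂ bounded v)

    length-neighbours : ∀ v → length (neighbours v) ≤ Δ
    length-neighbours v = proj₁ (proj₂ (proj₂ bounded v))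

    ∈-neighbours : ∀ {v w} → E G v w → w ∈ neighbours v
    ∈-neighbours {v} {w} = proj₂ (proj₂ (proj₂ bounded v)) w

  ball : V G → ℕ → List (V G)
  ball u zero    = u ∷ []
  ball u (suc r) = u ∷ concatMap (λ w → ball w r) (neighbours u)

  ballSize : ℕ → ℕ
  ballSize zero    = 1
  ballSize (suc r) = suc (Δ * ballSize r)

  length-ball : ∀ u r → length (ball u r) ≤ ballSize r
  length-ball u zero    = ≤-refl
  length-ball u (suc r) =
    s≤s (≤-trans (length-concatMap-≤ (neighbours u) (λ w → length-ball w r))
                 (*-monoˡ-≤ (ballSize r) (length-neighbours u)))

  ∈-ball : ∀ {u v r} → DistLe G u v r → v ∈ ball u r
  ∈-ball {r = zero}  (_ , z≤n , here) = here refl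
  ∈-ball {r = suc r} (_ , _ , here)   = here refl
  ∈-ball {r = suc r} (suc m , s≤s m≤r , step e ω) =
    there (∈-concatMap⁺ (λ w → ball w r)
                        (Any.map (λ { refl → ∈-ball (m , m≤r , ω) }) (∈-neighbours e)))

  pigeonhole-ball : ∀ {n r} c (u : Fin n → V G) → (∀ i → DistLe G c (u i) r) →
                    ballSize r < n → ∃₂ λ i j → i Fin.< j × u i ≡ u j
  pigeonhole-ball {r = r} c u near size<n =
    let i , j , i<j , same-position = pigeonhole (≤-<-trans (length-ball c r) size<n) position
    in i , j , i<j , (begin
      u i                            ≡⟨ lookup-index (u∈ball i) ⟩
      lookup (ball c r) (position i) ≡⟨ cong (lookup (ball c r)) same-position ⟩
      lookup (ball c r) (position j) ≡⟨ lookup-index (u∈ball j) ⟨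
      u j                            ∎)
    where
    open ≡-Reasoning
    u∈ball = λ i → ∈-ball (near i)
    position = λ i → Any.index (u∈ball i)

  module _ {r} (S : Pred (V G) 0ℓ) (S-close : ∀ {u v} → S u → S v → DistLe G u v r)
           {Ls : Fin (suc (ballSize r)) → List (V G)}
           (disjoint : ∀ {i j x} → x ∈ Ls i → x ∈ Ls j → i ≡ j) where

    ¬all-meet : ¬ (∀ i → Any S (Ls i))
    ¬all-meet meets =
      let i , j , i<j , uᵢ≡uⱼ =
            pigeonhole-ball (u Fin.zero) u (λ i → S-close (u∈S Fin.zero) (u∈S i)) ≤-refl
      in <⇒≢ᶠ i<j (disjoint (u∈L i) (subst (_∈ Ls j) (sym uᵢ≡uⱼ) (u∈L j)))
      where
      u   = λ i → proj₁ (find (meets i))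
      u∈L = λ i → proj₁ (proj₂ (find (meets i)))
      u∈S = λ i → proj₂ (proj₂ (find (meets i)))

    some-avoids : ¬ ¬ (∃[ i ] All (¬_ ∘ S) (Ls i))
    some-avoids none = ¬¬-pull-Fin (λ i ¬meet → none (i , ¬Any⇒All¬ (Ls i) ¬meet)) ¬all-meet

chain-linked : ∀ {G : Graph} {a b xs ys} →
               Chain G a xs b → Linked (E G) (b ∷ ys) → Linked (E G) (a ∷ xs ++ b ∷ ys)
chain-linked (last e)   linked = e ∷ linked
chain-linked (cons e c) linked = e ∷ chain-linked c linked

module SubdivisionImage {H G : Graph} (S : Subdivision H G) where

  open Subdivision S

  data Route (Q : Pred (V H) 0ℓ) : V H → Set where
    stop : ∀ {p} → Q p → Route Q p
    go   : ∀ {p q} → Q p → E H p q → Route Q q → Route Q p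

  private variable
    Q Q′ : Pred (V H) 0ℓ
    p p′ : V H
    x : V G

  image-after : Route Q p → List (V G)
  image-after (stop _)           = []
  image-after (go {p} {q} _ e ρ) = path p q e ++ φ q ∷ image-after ρ

  image : Route Q p → List (V G)
  image {p = p} ρ = φ p ∷ image-after ρ

  image-linked : (ρ : Route Q p) → Linked (E G) (image ρ)
  image-linked (stop _)           = [-]
  image-linked (go {p} {q} _ e ρ) = chain-linked (isChain p q e) (image-linked ρ)

  vertices : Route Q p → List (V H)
  vertices {p = p} (stop _)   = p ∷ []
  vertices {p = p} (go _ _ ρ) = p ∷ vertices ρ

  ∈-image : ∀ {ρ : Route Q p′} → p ∈ vertices ρ → φ p ∈ image ρ
  ∈-image {ρ = stop _}           (here refl) = here refl
  ∈-image {ρ = go _ _ _}         (here refl) = here refl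
  ∈-image {ρ = go {p} {q} _ e _} (there p∈)  = there (∈-++⁺ʳ (path p q e) (∈-image p∈))

  -- x lies on the subdivided copy of the part of H inside Q.
  data Over (Q : Pred (V H) 0ℓ) (x : V G) : Set where
    vertex : ∀ {p} → Q p → x ≡ φ p → Over Q x
    edge   : ∀ {p q} → Q p → Q q → (e : E H p q) → x ∈ path p q e → Over Q x

  route-head : Route Q p → Q p
  route-head (stop qp)   = qp
  route-head (go qp _ _) = qp

  image-over : (ρ : Route Q p) → x ∈ image ρ → Over Q x
  image-over ρ (here x≡φp) = vertex (route-head ρ) x≡φp
  image-over (go {p} {q} qp e ρ) (there x∈) with ∈-++⁻ (path p q e) x∈
  ... | inj₁ x∈path = edge qp (route-head ρ) e x∈path
  ... | inj₂ x∈ρ    = image-over ρ x∈ρ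

  over-meet : Over Q x → Over Q′ x → ∃[ p ] Q p × Q′ p
  over-meet (vertex qp refl) (vertex q′p′ x≡φp′) with φ-inj x≡φp′
  ... | refl = _ , qp , q′p′
  over-meet (vertex _ refl) (edge _ _ e x∈) = ⊥-elim (avoidImg _ _ e _ _ x∈ refl)
  over-meet (edge _ _ e x∈) (vertex _ x≡φp) = ⊥-elim (avoidImg _ _ e _ _ x∈ x≡φp)
  over-meet (edge qp qq e x∈) (edge q′p′ q′q′ e′ x∈′)
    with disjoint _ _ e _ _ e′ _ x∈ x∈′
  ... | inj₁ (refl , refl) = _ , qp , q′p′
  ... | inj₂ (refl , refl) = _ , qp , q′q′

  images-meet : (ρ : Route Q p) (ρ′ : Route Q′ p′) →
                x ∈ image ρ → x ∈ image ρ′ → ∃[ p ] Q p × Q′ p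
  images-meet ρ ρ′ x∈ x∈′ = over-meet (image-over ρ x∈) (image-over ρ′ x∈′)

record Mesh (G : Graph) (k : ℕ) : Set where
  field
    row col       : Fin k → List (V G)
    row-linked    : ∀ i → Linked (E G) (row i)
    col-linked    : ∀ j → Linked (E G) (col j)
    rows-disjoint : ∀ {i i′ x} → x ∈ row i → x ∈ row i′ → i ≡ i′
    cols-disjoint : ∀ {j j′ x} → x ∈ col j → x ∈ col j′ → j ≡ j′
    hub           : Fin k → Fin k → V G
    hub∈row       : ∀ i j → hub i j ∈ row i
    hub∈col       : ∀ i j → hub i j ∈ col j

⌊n*2/2⌋≡n : ∀ n → ⌊ n * 2 /2⌋ ≡ n
⌊n*2/2⌋≡n zero    = refl
⌊n*2/2⌋≡n (suc n) = cong suc (⌊n*2/2⌋≡n n)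

⌊n*2+1/2⌋≡n : ∀ n → ⌊ n * 2 + 1 /2⌋ ≡ n
⌊n*2+1/2⌋≡n zero    = refl
⌊n*2+1/2⌋≡n (suc n) = cong suc (⌊n*2+1/2⌋≡n n)

isEven-double : ∀ n → T (isEven (+ (n * 2)))
isEven-double n rewrite m*n%n≡0 n 2 ⦃ _ ⦄ = tt

m*2+1+[1+n*2]≡[1+m+n]*2 : ∀ m n → m * 2 + 1 + suc (n * 2) ≡ suc (m + n) * 2
m*2+1+[1+n*2]≡[1+m+n]*2 = solve-∀

vertical : ∀ x y m → x + y ≡ m * 2 → E HalfGrid (+ x , y) (+ x , suc y)
vertical x y m x+y≡2m =
  inj₁ (vert (+ x) y (subst (T ∘ isEven ∘ +_) (sym x+y≡2m) (isEven-double m)))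

module HalfGridMesh {G : Graph} (S : Subdivision HalfGrid G) where

  open Subdivision S
  open SubdivisionImage S

  -- Row i runs along height 2i; column j climbs the hexagons between x = 2j and x = 2j + 1.
  -- Rows (columns) are level sets of ⌊_/2⌋ applied to y (to |x|), so distinct ones are disjoint.
  OnRow : ℕ → Pred (V HalfGrid) 0ℓ
  OnRow i (_ , y) = ⌊ y /2⌋ ≡ i

  OnColumn : ℕ → Pred (V HalfGrid) 0ℓ
  OnColumn j (x , _) = ⌊ ℤ.∣ x ∣ /2⌋ ≡ j

  horizontal : (i x n : ℕ) → Route (OnRow i) (+ x , i * 2)
  horizontal i x zero    = stop (⌊n*2/2⌋≡n i)
  horizontal i x (suc n) =
    go (⌊n*2/2⌋≡n i) (inj₁ (horiz (+ x) (i * 2))) (horizontal i (x + 1) n)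

  zigzag : (j h n : ℕ) → Route (OnColumn j) (+ (j * 2) , h * 2)
  zigzag j h zero    = stop (⌊n*2/2⌋≡n j)
  zigzag j h (suc n) =
    go (⌊n*2/2⌋≡n j) (vertical (j * 2) (h * 2) (j + h) (sym (*-distribʳ-+ 2 j h)))
    (go (⌊n*2/2⌋≡n j) (inj₁ (horiz (+ (j * 2)) (suc (h * 2))))
    (go (⌊n*2+1/2⌋≡n j)
        (vertical (j * 2 + 1) (suc (h * 2)) (suc (j + h)) (m*2+1+[1+n*2]≡[1+m+n]*2 j h))
    (go (⌊n*2+1/2⌋≡n j) (inj₂ (horiz (+ (j * 2)) (suc (suc (h * 2)))))
    (zigzag j (suc h) n))))

  ∈-horizontal : ∀ i {x m n} → m ≤ n → (+ (x + m) , i * 2) ∈ vertices (horizontal i x n)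
  ∈-horizontal i {x} {zero} {zero}  _ = here (cong (λ z → + z , _) (+-identityʳ x))
  ∈-horizontal i {x} {zero} {suc _} _ = here (cong (λ z → + z , _) (+-identityʳ x))
  ∈-horizontal i {x} {suc m} {suc n} (s≤s m≤n) =
    there (subst (λ z → (+ z , i * 2) ∈ vertices (horizontal i (x + 1) n))
                 (+-assoc x 1 m) (∈-horizontal i m≤n))

  ∈-zigzag : ∀ j {h m n} → m ≤ n → (+ (j * 2) , (h + m) * 2) ∈ vertices (zigzag j h n)
  ∈-zigzag j {h} {zero} {zero}  _ = here (cong (λ z → _ , z * 2) (+-identityʳ h))
  ∈-zigzag j {h} {zero} {suc _} _ = here (cong (λ z → _ , z * 2) (+-identityʳ h))
  ∈-zigzag j {h} {suc m} {suc n} (s≤s m≤n) = there (there (there (there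
    (subst (λ z → (+ (j * 2) , z * 2) ∈ vertices (zigzag j (suc h) n))
           (sym (+-suc h m)) (∈-zigzag j m≤n)))))

  halfGrid-mesh : ∀ k → Mesh G k
  halfGrid-mesh k = record
    { row           = image ∘ row-route
    ; col           = image ∘ col-route
    ; row-linked    = image-linked ∘ row-route
    ; col-linked    = image-linked ∘ col-route
    ; rows-disjoint = λ x∈ x∈′ → toℕ-injective (same-level (images-meet (row-route _) (row-route _) x∈ x∈′))
    ; cols-disjoint = λ x∈ x∈′ → toℕ-injective (same-level (images-meet (col-route _) (col-route _) x∈ x∈′))
    ; hub           = λ i j → φ (+ (toℕ j * 2) , toℕ i * 2)
    ; hub∈row       = λ i j → ∈-image {ρ = row-route i} (∈-horizontal (toℕ i) (*-monoˡ-≤ 2 (j<k j)))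
    ; hub∈col       = λ i j → ∈-image {ρ = col-route j} (∈-zigzag (toℕ j) (j<k i))
    }
    where
    j<k = λ (j : Fin k) → <⇒≤ (toℕ<n j)
    row-route = λ (i : Fin k) → horizontal (toℕ i) 0 (k * 2)
    col-route = λ (j : Fin k) → zigzag (toℕ j) 0 k
    same-level : ∀ {A : Set} {g : V HalfGrid → A} {a b} → ∃[ p ] g p ≡ a × g p ≡ b → a ≡ b
    same-level (_ , ga , gb) = trans (sym ga) gb

module QuasiTree (G : Graph) (simple : IsSimple G) (bounded : BoundedDegree G)
                 (T : Graph) (tree : IsTree T) (f : V G → V T) {γ c} (qi : IsQI G T f γ c) where

  private
    symG : ∀ {u v} → E G u v → E G v u
    symG = proj₁ simple _ _

    symT : ∀ {x y} → E T x y → E T y x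
    symT = proj₁ (proj₁ tree) _ _

    irreflexiveT : ∀ x → ¬ E T x x
    irreflexiveT = proj₂ (proj₁ tree)

    connected : Connected T
    connected = proj₁ (proj₂ tree)

  open Walks T using (dist-trans; dist-sym)
  open Branches T symT (proj₂ (proj₂ tree))
  open Balls G bounded

  L R size : ℕ
  L = γ * 1 + c
  R = γ * ((L + L) + c)
  size = suc (ballSize R)

  Near : V T → Pred (V G) 0ℓ
  Near t v = DistLe T (f v) t L

  edge-close : ∀ {u w} → E G u w → DistLe T (f u) (f w) L
  edge-close e = proj₁ (proj₂ qi) _ _ 1 (1 , ≤-refl , step e here)

  near-close : ∀ {t u w} → Near t u → Near t w → DistLe G u w R
  near-close near-u near-w =
    proj₁ (proj₂ (proj₂ qi)) _ _ (L + L) (dist-trans near-u (dist-sym symT near-w))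

  InBranch : V T → V T → Pred (V G) 0ℓ
  InBranch t s v = ¬ ¬ Branch t s (f v)

  -- Along an edge of G, f moves by at most L, so it cannot jump over t without coming L-close to it.
  linked-in-branch : ∀ {t s xs v} → Linked (E G) xs → All (¬_ ∘ Near t) xs →
                     v ∈ xs → InBranch t s v → All (InBranch t s) xs
  linked-in-branch {t} {s} linked far v∈ v-in = linked-spread symG along-edge linked far (lose v∈ v-in)
    where
    along-edge : ∀ {x y} → E G x y → ¬ Near t y → InBranch t s x → InBranch t s y
    along-edge e ¬near x-in = x-in >>= branch-stable (edge-close (symG e)) ¬near

  module _ (M : Mesh G size) where

    open Mesh M

    avoiding-cross : ∀ t →
                     ¬ ¬ (∃₂ λ i j → All (¬_ ∘ Near t) (row i) × All (¬_ ∘ Near t) (col j))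
    avoiding-cross t = do
      (i , row-far) ← some-avoids (Near t) near-close rows-disjoint
      (j , col-far) ← some-avoids (Near t) near-close cols-disjoint
      return (i , j , row-far , col-far)

    Toward : V T → V T → Set
    Toward t s = ∃₂ λ i j → All (InBranch t s) (row i) × All (InBranch t s) (col j)

    toward : ∀ t → ¬ ¬ (∃[ s ] E T t s × Toward t s)
    toward t = do
      (i , j , row-far , col-far) ← avoiding-cross t
      let h-far = All.lookup row-far (hub∈row i j)
      (s , t–s , h∈) ← branch-of connected λ { refl → h-far (0 , z≤n , here) }
      return (s , t–s , i , j , linked-in-branch (row-linked i) row-far (hub∈row i j) (return h∈)
                              , linked-in-branch (col-linked j) col-far (hub∈col i j) (return h∈))

    toward-antisym : ∀ {a b} → E T a b → Toward a b → ¬ Toward b a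
    toward-antisym a–b (i , _ , row-ab , _) (_ , j , _ , col-ba) =
      All.lookup row-ab (hub∈row i j) λ h∈ab →
      All.lookup col-ba (hub∈col i j) λ h∈ba → branches-disjoint a–b h∈ab h∈ba

    t₀ : V T
    t₀ = f (hub Fin.zero Fin.zero)

    hub-distance : Fin size → Fin size → ℕ
    hub-distance i j = proj₁ (connected t₀ (f (hub i j)))

    row-radius : Fin size → ℕ
    row-radius i = proj₁ (finite-bound (hub-distance i))

    radius : ℕ
    radius = proj₁ (finite-bound row-radius)

    hub-near : ∀ i j → DistLe T t₀ (f (hub i j)) radius
    hub-near i j = hub-distance i j
                 , ≤-trans (proj₂ (finite-bound (hub-distance i)) j) (proj₂ (finite-bound row-radius) i)
                 , proj₂ (connected t₀ (f (hub i j)))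

    orientation : AnchoredOrientation t₀ radius
    orientation = record
      { Points   = Toward
      ; points   = toward
      ; antisym  = toward-antisym
      ; anchored = λ (i , j , row-in , _) → do
          h∈ ← All.lookup row-in (hub∈row i j)
          return (f (hub i j) , h∈ , hub-near i j)
      }

  no-mesh : ¬ Mesh G size
  no-mesh M = ¬anchored-orientation irreflexiveT (orientation M)

mainTheorem6 : (G : Graph) → IsSimple G → BoundedDegree G →
    QuasiIsometricToTree G → ¬ Subdivision HalfGrid G
mainTheorem6 G simple bounded (T , tree , f , _ , _ , qi) subdivision =
  no-mesh (halfGrid-mesh size)
  where
  open QuasiTree G simple bounded T tree f qi
  open HalfGridMesh subdivision
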